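{- Let $W=\{w_1,\dots,w_n\}\subseteq\mathbb{TP}^4$, and for each $i\in\{1,\dots,5\}$ let $H_i$ be a tropical hyperplane containing every point of $W$ such that $H_i$ is an $i$-coordinate hyperplane for $W$. Suppose that for every pair $i\ne j$, some point of $W$ is a witness for $H_i$ and $H_j$. Let $i,j,k,l$ be distinct elements of $\{1,\dots,5\}$. Then it is not possible that both $H_i$ and $H_k$ have a witness in $W$ of type $jl$ and $H_i$ and $H_j$ have a witness in $W$ of type $kl$.
   Context: $\mathbb{TP}^{4}=\mathbb R^5/\mathbb R(1,\dots,1)$. A tropical hyperplane is $H=h_1\odot x_1\oplus\cdots\oplus h_5\odot x_5$ with $h_r\in\mathbb R$; for a point $w$, $\mathrm{type}_H w$ is the set of indices $r$ at which $\min_s(h_s+w_s)$ is attained, and $w\in H$ iff $|\mathrm{type}_H w|\ge2$. $H$ is an $i$-coordinate hyperplane for $W$ if $H$ contains every point of $W$ and $i\notin\mathrm{type}_H w$ for all $w\in W$. Stable intersection: $w$ lies in the stable intersection of hyperplanes $H,H'$ iff for every $\varepsilon>0$ there is $\delta>0$ such that for every $v\in\mathbb R^5$ with $\|v\|_\infty<\delta$ some $\tilde w\in H\cap(H'+v)$ has $\|\tilde w-w\|_\infty<\varepsilon$. A witness for $H,H'$ is a point lying on both $H$ and $H'$ but not in their stable intersection; such a point always satisfies $\mathrm{type}_H w=\mathrm{type}_{H'}w=\{a,b\}$ for some $a\ne b$, and it is then called a witness of type $ab$. -}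

module Defs where

open import Level using (0ℓ)
open import Data.Fin using (Fin)
open import Data.Nat using (ℕ)
open import Data.Product using (Σ; ∃; ∃-syntax; _×_; _,_)
open import Data.Sum using (_⊎_)
open import Relation.Nullary using (¬_)
open import Relation.Binary.PropositionalEquality using (_≡_)
open import Function.Bundles using (_⇔_)

-- The real numbers, axiomatised as a complete ordered field
-- (any two models are isomorphic, so quantifying over all models
-- is the same as speaking about ℝ).
record RealField : Set₁ where
  infixl 6 _+_
  infixl 7 _*_
  infix 4 _<_ _≤_
  field
    ℝ : Set
    0r 1r : ℝ
    _+_ _*_ : ℝ → ℝ → ℝ
    -_ : ℝ → ℝ
    inv : (x : ℝ) → ¬ (x ≡ 0r) → ℝ
    _<_ : ℝ → ℝ → Set
    +-assoc : ∀ x y z → (x + y) + z ≡ x + (y + z)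
    +-comm : ∀ x y → x + y ≡ y + x
    +-identityʳ : ∀ x → x + 0r ≡ x
    +-inverseʳ : ∀ x → x + (- x) ≡ 0r
    *-assoc : ∀ x y z → (x * y) * z ≡ x * (y * z)
    *-comm : ∀ x y → x * y ≡ y * x
    *-identityʳ : ∀ x → x * 1r ≡ x
    distribˡ : ∀ x y z → x * (y + z) ≡ x * y + x * z
    inv-inverse : ∀ x (p : ¬ (x ≡ 0r)) → x * inv x p ≡ 1r
    0≢1 : ¬ (0r ≡ 1r)
    <-irrefl : ∀ x → ¬ (x < x)
    <-trans : ∀ {x y z} → x < y → y < z → x < z
    <-trichotomy : ∀ x y → (x < y) ⊎ (x ≡ y) ⊎ (y < x)
    +-mono-< : ∀ {x y} z → x < y → x + z < y + z
    *-pos : ∀ {x y} → 0r < x → 0r < y → 0r < x * y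
  _≤_ : ℝ → ℝ → Set
  x ≤ y = (x < y) ⊎ (x ≡ y)
  field
    sup : (P : ℝ → Set) → ∃ P → (∃[ b ] (∀ x → P x → x ≤ b)) →
          ∃[ s ] ((∀ x → P x → x ≤ s) × (∀ b → (∀ x → P x → x ≤ b) → s ≤ b))

-- Tropical notions in TP^4, points/coefficients given by representatives
-- in ℝ^5 = Fin 5 → ℝ (all notions below are invariant under adding
-- constant vectors). Coordinates are indexed by Fin 5 = {0,…,4}.
module Tropical (R : RealField) where
  open RealField R

  _-_ : ℝ → ℝ → ℝ
  x - y = x + (- y)

  Pt : Set
  Pt = Fin 5 → ℝ

  -- a hyperplane H = h₁ ⊙ x₁ ⊕ ⋯ ⊕ h₅ ⊙ x₅ given by its coefficient vector
  Hyp : Set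
  Hyp = Fin 5 → ℝ

  InType : Hyp → Pt → Fin 5 → Set
  InType h w r = ∀ s → h r + w r ≤ h s + w s

  OnHyp : Hyp → Pt → Set
  OnHyp h w = ∃[ r ] ∃[ r' ] (¬ (r ≡ r') × InType h w r × InType h w r')

  CoordHyp : ∀ {n} → (Fin n → Pt) → Hyp → Fin 5 → Set
  CoordHyp W h i = ∀ m → OnHyp h (W m) × ¬ InType h (W m) i

  NormLt : (Fin 5 → ℝ) → ℝ → Set
  NormLt v δ = ∀ r → (- δ < v r) × (v r < δ)

  -- the translate H' + v = { x | x - v ∈ H' }
  translate : Hyp → (Fin 5 → ℝ) → Hyp
  translate h v r = h r - v r

  InStable : Hyp → Hyp → Pt → Set
  InStable h h' w =
    ∀ ε → 0r < ε → ∃[ δ ] (0r < δ × (∀ v → NormLt v δ →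
      ∃[ w~ ] (OnHyp h w~ × OnHyp (translate h' v) w~ × NormLt (λ r → w~ r - w r) ε)))

  Witness : Hyp → Hyp → Pt → Set
  Witness h h' w = OnHyp h w × OnHyp h' w × ¬ InStable h h' w

  TypeIs : Hyp → Pt → Fin 5 → Fin 5 → Set
  TypeIs h w a b = ∀ r → InType h w r ⇔ ((r ≡ a) ⊎ (r ≡ b))

  WitnessOfType : Hyp → Hyp → Pt → Fin 5 → Fin 5 → Set
  WitnessOfType h h' w a b =
    ¬ (a ≡ b) × Witness h h' w × TypeIs h w a b × TypeIs h' w a b

-- Write γ, α, β for H_i, H_j, H_k, and say that p precedes q for (α, β) when
-- α p + β q < α q + β p.  Comparing the witness w (type jl) with the witness w'
-- (type kl) on γ shows k ∉ type_α w and j ∉ type_β w'.  Since α is a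
-- j-coordinate hyperplane containing w, type_α w therefore contains an index s
-- outside {j, k, l}; then s precedes l, because s ∉ type_β w = {j, l}.
-- Symmetrically an index t ∈ type_β w' outside {j, k, l} is preceded by l, so
-- j, k, l, s, t are distinct.  Finally take a witness u for (α, β).  If some
-- index of type_β u were outside type_α u, moving that single coordinate of u
-- would follow every small translate of β while staying on α, putting u in the
-- stable intersection.  So the two (or more) indices of type_β u lie in type_α u,
-- hence among l, s, t; but two indices in the common type of α and β at u are
-- never in precedence, while any two of s ≺ l ≺ t are.
module Submission where

open import Level using (0ℓ)
open import Defs
open import Data.Nat as ℕ using (ℕ; suc)
open import Data.Nat.Properties using (1+n≰n)
open import Data.Fin as Fin using (Fin; punchIn; punchOut)
open import Data.Fin.Properties using (_≟_; punchInᵢ≢i; punchIn-punchOut; injective⇒≤)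
open import Data.Vec using (Vec; []; _∷_)
open import Data.Vec.Functional using (updateAt)
open import Data.Vec.Functional.Properties using (updateAt-updates; updateAt-minimal)
open import Data.Vec.Membership.Propositional using (_∈_)
open import Data.Vec.Relation.Unary.Any using (here; there)
open import Data.Vec.Relation.Unary.All using ([]; _∷_; decide)
open import Data.Vec.Relation.Unary.Unique.Propositional using (Unique; []; _∷_)
open import Data.Vec.Relation.Unary.Unique.Propositional.Properties using (lookup-injective)
open import Data.Product using (∃-syntax; _×_; _,_; proj₁; proj₂)
open import Data.Sum using (_⊎_; inj₁; inj₂; [_,_]′; swap)
open import Data.Empty using (⊥)
open import Data.Maybe using (nothing)
open import Function.Bundles using (Equivalence)
open import Relation.Nullary using (¬_; yes; no; contradiction)
open import Relation.Nullary.Decidable using (toSum)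
open import Relation.Binary.Definitions using (Transitive)
open import Relation.Binary.PropositionalEquality
open import Algebra.Bundles using (CommutativeRing; AbelianGroup)
open import Tactic.RingSolver.Core.AlmostCommutativeRing using (fromCommutativeRing)
import Relation.Binary.Construct.StrictToNonStrict as StrictToNonStrict

-- Pigeonhole: n pairwise distinct elements of Fin n exhaust Fin n, since a
-- missing r could be prepended to give n + 1 distinct elements of Fin n.
distinct-exhaust : ∀ {n} (xs : Vec (Fin n) n) → Unique xs → ∀ r → r ∈ xs
distinct-exhaust xs xs-unique r with decide (λ x → swap (toSum (r ≟ x))) xs
... | inj₂ r∈xs = r∈xs
... | inj₁ r∉xs =
  contradiction (injective⇒≤ λ {a} {b} → lookup-injective (r∉xs ∷ xs-unique) a b) 1+n≰n

remaining : ∀ {j k l s t r : Fin 5} → Unique (j ∷ k ∷ l ∷ s ∷ t ∷ []) →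
            r ≢ j → r ≢ k → r ∈ (l ∷ s ∷ t ∷ [])
remaining distinct r≢j r≢k with distinct-exhaust _ distinct _
... | here r≡j = contradiction r≡j r≢j
... | there (here r≡k) = contradiction r≡k r≢k
... | there (there r∈lst) = r∈lst

chain-comparable : ∀ {A : Set} {_≺_ : A → A → Set} {l s t x y : A} → Transitive _≺_ →
                   s ≺ l → l ≺ t → x ∈ (l ∷ s ∷ t ∷ []) → y ∈ (l ∷ s ∷ t ∷ []) →
                   x ≢ y → (x ≺ y) ⊎ (y ≺ x)
chain-comparable _ _ _ (here refl) (here refl) x≢y = contradiction refl x≢y
chain-comparable _ s≺l _ (here refl) (there (here refl)) _ = inj₂ s≺l
chain-comparable _ _ l≺t (here refl) (there (there (here refl))) _ = inj₁ l≺t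
chain-comparable _ s≺l _ (there (here refl)) (here refl) _ = inj₁ s≺l
chain-comparable _ _ _ (there (here refl)) (there (here refl)) x≢y = contradiction refl x≢y
chain-comparable trans s≺l l≺t (there (here refl)) (there (there (here refl))) _ =
  inj₁ (trans s≺l l≺t)
chain-comparable _ _ l≺t (there (there (here refl))) (here refl) _ = inj₂ l≺t
chain-comparable trans s≺l l≺t (there (there (here refl))) (there (here refl)) _ =
  inj₂ (trans s≺l l≺t)
chain-comparable _ _ _ (there (there (here refl))) (there (there (here refl))) x≢y =
  contradiction refl x≢y

module OrderedFieldFacts (R : RealField) where
  open RealField R
  open Tropical R using (_-_)

  commutativeRing : CommutativeRing 0ℓ 0ℓ
  commutativeRing = record
    { Carrier = ℝ ; _≈_ = _≡_ ; _+_ = _+_ ; _*_ = _*_ ; -_ = -_ ; 0# = 0r ; 1# = 1r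
    ; isCommutativeRing = record
      { isRing = record
        { +-isAbelianGroup = record
          { isGroup = record
            { isMonoid = record
              { isSemigroup = record
                { isMagma = record { isEquivalence = isEquivalence ; ∙-cong = cong₂ _+_ }
                ; assoc = +-assoc }
              ; identity = (λ x → trans (+-comm 0r x) (+-identityʳ x)) , +-identityʳ }
            ; inverse = (λ x → trans (+-comm (- x) x) (+-inverseʳ x)) , +-inverseʳ
            ; ⁻¹-cong = cong (λ x → - x) }
          ; comm = +-comm }
        ; *-cong = cong₂ _*_
        ; *-assoc = *-assoc
        ; *-identity = (λ x → trans (*-comm 1r x) (*-identityʳ x)) , *-identityʳ
        ; distrib = distribˡ , λ x y z → trans (*-comm (y + z) x)
                      (trans (distribˡ x y z) (cong₂ _+_ (*-comm x y) (*-comm x z))) }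
      ; *-comm = *-comm } }

  open CommutativeRing commutativeRing using (+-identityˡ; *-identityˡ; distribʳ; zeroʳ)
  open import Algebra.Properties.Group (AbelianGroup.group (CommutativeRing.+-abelianGroup commutativeRing))
    using (\\-leftDividesˡ; //-rightDividesʳ; ⁻¹-involutive; ε⁻¹≈ε)
  open import Algebra.Properties.AbelianGroup (CommutativeRing.+-abelianGroup commutativeRing)
    using (⁻¹-∙-comm)
  open import Algebra.Properties.CommutativeSemigroup (CommutativeRing.+-commutativeSemigroup commutativeRing)
    using (interchange)
  open import Algebra.Properties.Ring (CommutativeRing.ring commutativeRing) using (-‿distribˡ-*; -‿distribʳ-*)
  open import Tactic.RingSolver.NonReflective (fromCommutativeRing commutativeRing (λ _ → nothing))
    using (solve; _⊜_; _⊕_; ⊝_)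
  private module NonStrict = StrictToNonStrict _≡_ _<_

  -- RealField's ≤ is the reflexive closure of <, so the library's lemmas on such
  -- closures give the mixed transitivity laws.
  ≤-trans : ∀ {x y z} → x ≤ y → y ≤ z → x ≤ z
  ≤-trans = NonStrict.trans isEquivalence (resp₂ _<_) <-trans

  <-≤-trans : ∀ {x y z} → x < y → y ≤ z → x < z
  <-≤-trans = NonStrict.<-≤-trans <-trans (λ {x} → subst (x <_))

  ≤-<-trans : ∀ {x y z} → x ≤ y → y < z → x < z
  ≤-<-trans = NonStrict.≤-<-trans sym <-trans (λ {x} → subst (_< x))

  <⇒≱ : ∀ {x y} → x < y → ¬ (y ≤ x)
  <⇒≱ {x} x<y y≤x = <-irrefl x (<-≤-trans x<y y≤x)

  +-monoʳ-< : ∀ {x y} z → x < y → z + x < z + y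
  +-monoʳ-< {x} {y} z x<y = subst₂ _<_ (+-comm x z) (+-comm y z) (+-mono-< z x<y)

  +-monoˡ-≤ : ∀ {x y} z → x ≤ y → x + z ≤ y + z
  +-monoˡ-≤ z (inj₁ x<y) = inj₁ (+-mono-< z x<y)
  +-monoˡ-≤ z (inj₂ x≡y) = inj₂ (cong (_+ z) x≡y)

  +-monoʳ-≤ : ∀ {x y} z → x ≤ y → z + x ≤ z + y
  +-monoʳ-≤ z (inj₁ x<y) = inj₁ (+-monoʳ-< z x<y)
  +-monoʳ-≤ z (inj₂ x≡y) = inj₂ (cong (z +_) x≡y)

  +-mono-≤-< : ∀ {a b c d} → a ≤ b → c < d → a + c < b + d
  +-mono-≤-< {b = b} {c = c} a≤b c<d = ≤-<-trans (+-monoˡ-≤ c a≤b) (+-monoʳ-< b c<d)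

  +-mono-≤ : ∀ {a b c d} → a ≤ b → c ≤ d → a + c ≤ b + d
  +-mono-≤ {b = b} {c = c} a≤b c≤d = ≤-trans (+-monoˡ-≤ c a≤b) (+-monoʳ-≤ b c≤d)

  +-cancelʳ-< : ∀ {x y} z → x + z < y + z → x < y
  +-cancelʳ-< {x} {y} z p = subst₂ _<_ (//-rightDividesʳ z x) (//-rightDividesʳ z y) (+-mono-< (- z) p)

  +-cancelʳ-≤ : ∀ {x y} z → x + z ≤ y + z → x ≤ y
  +-cancelʳ-≤ z (inj₁ p) = inj₁ (+-cancelʳ-< z p)
  +-cancelʳ-≤ {x} {y} z (inj₂ e) =
    inj₂ (trans (sym (//-rightDividesʳ z x)) (trans (cong (_- z) e) (//-rightDividesʳ z y)))

  neg-antitone : ∀ {x y} → x < y → - y < - x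
  neg-antitone {x} {y} x<y = subst₂ _<_ (\\-leftDividesˡ x (- y))
    (trans (cong (y +_) (+-comm (- x) (- y))) (\\-leftDividesˡ y (- x))) (+-mono-< (- x + - y) x<y)

  neg-antitone-≤ : ∀ {x y} → x ≤ y → - y ≤ - x
  neg-antitone-≤ (inj₁ x<y) = inj₁ (neg-antitone x<y)
  neg-antitone-≤ (inj₂ x≡y) = inj₂ (cong (λ z → - z) (sym x≡y))

  neg-pos : ∀ {x} → x < 0r → 0r < - x
  neg-pos x<0 = subst (_< _) ε⁻¹≈ε (neg-antitone x<0)

  +-sub : ∀ a b → a + (b - a) ≡ b
  +-sub a b = trans (cong (a +_) (+-comm b (- a))) (\\-leftDividesˡ a b)

  +-subˡ : ∀ a d → (a + d) - a ≡ d
  +-subˡ a d = trans (cong (_- a) (+-comm a d)) (//-rightDividesʳ a d)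

  exchange< : ∀ {a b c d x y} → a + x ≤ b + y → c + y < d + x → a + c < b + d
  exchange< {a} {b} {c} {d} {x} {y} p q = +-cancelʳ-< (x + y)
    (subst₂ _<_ (interchange a x c y) (trans (interchange b y d x) (cong ((b + d) +_) (+-comm y x)))
      (+-mono-≤-< p q))

  exchange≤ : ∀ {a b c d x y} → a + x ≤ b + y → c + y ≤ d + x → a + c ≤ b + d
  exchange≤ {a} {b} {c} {d} {x} {y} p q = +-cancelʳ-≤ (x + y)
    (subst₂ _≤_ (interchange a x c y) (trans (interchange b y d x) (cong ((b + d) +_) (+-comm y x)))
      (+-mono-≤ p q))

  sub-pos : ∀ {a b} → a < b → 0r < b - a
  sub-pos {a} {b} a<b = subst (_< b - a) (+-inverseʳ a) (+-mono-< (- a) a<b)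

  nonpos-+ : ∀ {a b e f} → a ≤ b → e < f → (a - b) + e < f
  nonpos-+ {a} {b} {e} {f} a≤b e<f = subst ((a - b) + e <_) (trans (cong (_+ f) (+-inverseʳ b)) (+-identityˡ f))
                                            (+-mono-≤-< (+-monoˡ-≤ (- b) a≤b) e<f)

  nonneg-+ : ∀ {a b e f} → b ≤ a → f < e → f < (a - b) + e
  nonneg-+ {a} {b} {e} {f} b≤a f<e = subst (_< (a - b) + e) (trans (cong (_+ f) (+-inverseʳ b)) (+-identityˡ f))
                                            (+-mono-≤-< (+-monoˡ-≤ (- b) b≤a) f<e)

  neg-sub-< : ∀ {a b d} → - (b - a) < d → a < b + d
  neg-sub-< {a} {b} {d} p = subst (_< b + d) b-[b-a]≡a (+-monoʳ-< b p)
    where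
    b-[b-a]≡a : b + - (b - a) ≡ a
    b-[b-a]≡a = trans (cong (b +_) (sym (⁻¹-∙-comm b (- a))))
                      (trans (cong (λ z → b + (- b + z)) (⁻¹-involutive a)) (\\-leftDividesˡ b a))

  -- The identity behind the size of the tie-making shift (see tie-shift-small):
  -- negations are expanded by hand, then the ring solver rearranges the atoms.
  translate-gap : ∀ a v b a' v' b' →
                  ((a - v) + b) - ((a' - v') + b') ≡ ((a + b) - (a' + b')) + (v' - v)
  translate-gap a v b a' v' b' = begin
    ((a - v) + b) - ((a' - v') + b')         ≡⟨ cong (((a - v) + b) +_) expand ⟩
    ((a - v) + b) + ((- a' + v') + - b')     ≡⟨ rearrange a (- v) b (- a') v' (- b') ⟩
    ((a + b) + (- a' + - b')) + (v' - v)     ≡⟨ cong (λ z → ((a + b) + z) + (v' - v)) (⁻¹-∙-comm a' b') ⟩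
    ((a + b) - (a' + b')) + (v' - v)         ∎
    where
    open ≡-Reasoning
    expand : - ((a' - v') + b') ≡ (- a' + v') + - b'
    expand = trans (sym (⁻¹-∙-comm (a' - v') b'))
                   (cong (_+ - b') (trans (sym (⁻¹-∙-comm a' (- v'))) (cong (- a' +_) (⁻¹-involutive v'))))
    rearrange : ∀ a nv b na' v' nb' →
                ((a + nv) + b) + ((na' + v') + nb') ≡ ((a + b) + (na' + nb')) + (v' + nv)
    rearrange = solve 6 (λ a nv b na' v' nb' →
      (((a ⊕ nv) ⊕ b) ⊕ ((na' ⊕ v') ⊕ nb')) ⊜ (((a ⊕ b) ⊕ (na' ⊕ nb')) ⊕ (v' ⊕ nv))) refl

  Within : ℝ → ℝ → Set
  Within ε x = (- ε < x) × (x < ε)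

  within-zero : ∀ {ε} → 0r < ε → Within ε 0r
  within-zero 0<ε = subst (_ <_) ε⁻¹≈ε (neg-antitone 0<ε) , 0<ε

  within-weaken : ∀ {m ε x} → m ≤ ε → Within m x → Within ε x
  within-weaken m≤ε (lo , hi) = ≤-<-trans (neg-antitone-≤ m≤ε) lo , <-≤-trans hi m≤ε

  diff-within : ∀ {δ x y} → Within δ x → Within δ y → Within (δ + δ) (x - y)
  diff-within {δ} {x} {y} (x-lo , x-hi) (y-lo , y-hi) =
    subst (_< x - y) (⁻¹-∙-comm δ δ) (+-mono-≤-< (inj₁ x-lo) (neg-antitone y-hi)) ,
    +-mono-≤-< (inj₁ x-hi) (subst (_ <_) (⁻¹-involutive δ) (neg-antitone y-lo))

  -- 1 is positive: otherwise -1 and hence (-1)(-1) = 1 would be positive.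
  0<1 : 0r < 1r
  0<1 with <-trichotomy 0r 1r
  ... | inj₁ 0<1 = 0<1
  ... | inj₂ (inj₁ 0≡1) = contradiction 0≡1 0≢1
  ... | inj₂ (inj₂ 1<0) = subst (0r <_) square (*-pos (neg-pos 1<0) (neg-pos 1<0))
    where
    square : - 1r * - 1r ≡ 1r
    square = trans (sym (-‿distribˡ-* 1r (- 1r)))
                   (trans (cong (λ z → - z) (*-identityˡ (- 1r))) (⁻¹-involutive 1r))

  inverse-pos : ∀ {x y} → 0r < x → x * y ≡ 1r → 0r < y
  inverse-pos {x} {y} 0<x xy≡1 with <-trichotomy 0r y
  ... | inj₁ 0<y = 0<y
  ... | inj₂ (inj₁ 0≡y) = contradiction (trans (sym (zeroʳ x)) (trans (cong (x *_) 0≡y) xy≡1)) 0≢1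
  ... | inj₂ (inj₂ y<0) = contradiction (<-trans 0<1 1<0) (<-irrefl 0r)
    where
    0<-1 : 0r < - 1r
    0<-1 = subst (0r <_) (trans (sym (-‿distribʳ-* x y)) (cong (λ z → - z) xy≡1)) (*-pos 0<x (neg-pos y<0))
    1<0 : 1r < 0r
    1<0 = subst₂ _<_ (⁻¹-involutive 1r) ε⁻¹≈ε (neg-antitone 0<-1)

  halve : ∀ {m} → 0r < m → ∃[ δ ] (0r < δ × δ + δ ≡ m)
  halve {m} 0<m = m * half , *-pos 0<m (inverse-pos 0<two (inv-inverse two two≢0)) ,
                  trans (sym (distribˡ m half half)) (trans (cong (m *_) two-halves) (*-identityʳ m))
    where
    two : ℝ
    two = 1r + 1r
    0<two : 0r < two
    0<two = subst (_< two) (+-identityʳ 0r) (+-mono-≤-< (inj₁ 0<1) 0<1)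
    two≢0 : two ≢ 0r
    two≢0 two≡0 = <-irrefl 0r (subst (0r <_) two≡0 0<two)
    half : ℝ
    half = inv two two≢0
    two-halves : half + half ≡ 1r
    two-halves = trans (sym (trans (distribʳ half 1r 1r) (cong₂ _+_ (*-identityˡ half) (*-identityˡ half))))
                       (inv-inverse two two≢0)

  small-positive : ∀ {a b} → 0r < a → 0r < b → ∃[ δ ] (0r < δ × δ + δ ≤ a × δ + δ ≤ b)
  small-positive {a} {b} 0<a 0<b with <-trichotomy a b | halve 0<a | halve 0<b
  ... | inj₁ a<b        | δ , 0<δ , 2δ≡a | _ =
    δ , 0<δ , inj₂ 2δ≡a , inj₁ (subst (_< b) (sym 2δ≡a) a<b)
  ... | inj₂ (inj₁ a≡b) | δ , 0<δ , 2δ≡a | _ =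
    δ , 0<δ , inj₂ 2δ≡a , inj₂ (trans 2δ≡a a≡b)
  ... | inj₂ (inj₂ b<a) | _ | δ , 0<δ , 2δ≡b =
    δ , 0<δ , inj₁ (subst (_< a) (sym 2δ≡b) b<a) , inj₂ 2δ≡b

  argmin : ∀ {n} (f : Fin (suc n) → ℝ) → ∃[ i ] (∀ x → f i ≤ f x)
  argmin {ℕ.zero} f = Fin.zero , λ { Fin.zero → inj₂ refl }
  argmin {suc n} f with argmin (λ x → f (Fin.suc x))
  ... | i , i-min with <-trichotomy (f Fin.zero) (f (Fin.suc i))
  ... | inj₁ lt = Fin.zero , λ { Fin.zero → inj₂ refl ; (Fin.suc x) → inj₁ (<-≤-trans lt (i-min x)) }
  ... | inj₂ (inj₁ eq) =
    Fin.zero , λ { Fin.zero → inj₂ refl ; (Fin.suc x) → subst (_≤ f (Fin.suc x)) (sym eq) (i-min x) }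
  ... | inj₂ (inj₂ gt) = Fin.suc i , λ { Fin.zero → inj₁ gt ; (Fin.suc x) → i-min x }

  argmin-except : ∀ {n} (f : Fin (suc (suc n)) → ℝ) (c : Fin (suc (suc n))) →
                  ∃[ s ] (s ≢ c × (∀ x → x ≢ c → f s ≤ f x))
  argmin-except f c with argmin (λ x → f (punchIn c x))
  ... | i , i-min = punchIn c i , punchInᵢ≢i c i ,
        λ x x≢c → subst (λ z → f (punchIn c i) ≤ f z) (punchIn-punchOut (≢-sym x≢c))
                        (i-min (punchOut (≢-sym x≢c)))

module TropicalFacts (R : RealField) where
  open RealField R
  open Tropical R
  open OrderedFieldFacts R

  type-∋₁ : ∀ {h w a b} → TypeIs h w a b → InType h w a
  type-∋₁ T = Equivalence.from (T _) (inj₁ refl)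

  type-∋₂ : ∀ {h w a b} → TypeIs h w a b → InType h w b
  type-∋₂ T = Equivalence.from (T _) (inj₂ refl)

  type-∌ : ∀ {h w a b r} → TypeIs h w a b → r ≢ a → r ≢ b → ¬ InType h w r
  type-∌ T r≢a r≢b h∋r = [ r≢a , r≢b ]′ (Equivalence.to (T _) h∋r)

  outside-larger : ∀ {h w a b} → InType h w a → ¬ InType h w b → h a + w a < h b + w b
  outside-larger {h} {w} {a} {b} h∋a h∌b with h∋a b
  ... | inj₁ smaller = smaller
  ... | inj₂ equal = contradiction (λ x → subst (_≤ h x + w x) equal (h∋a x)) h∌b

  other-index : ∀ {h w} → OnHyp h w → (c : Fin 5) → ∃[ d ] (d ≢ c × InType h w d)
  other-index (r , r' , r≢r' , h∋r , h∋r') c with r ≟ c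
  ... | yes refl = r' , ≢-sym r≢r' , h∋r'
  ... | no r≢c = r , r≢c , h∋r

  third-index : ∀ {h w j k l} → OnHyp h w → ¬ InType h w j → ¬ InType h w k →
                ∃[ s ] (InType h w s × s ≢ j × s ≢ k × s ≢ l)
  third-index {l = l} on h∌j h∌k with other-index on l
  ... | s , s≢l , h∋s = s , h∋s , (λ { refl → h∌j h∋s }) , (λ { refl → h∌k h∋s }) , s≢l

  -- p precedes q for the pair (h, h') when the tropical 2×2 minor of h, h' on
  -- the columns p, q is attained only on its diagonal.
  record Precedes (h h' : Hyp) (p q : Fin 5) : Set where
    constructor precedes
    field minor-diagonal : h p + h' q < h q + h' p

  precedes-irrefl : ∀ {h h' p} → ¬ Precedes h h' p p
  precedes-irrefl (precedes p≺p) = <-irrefl _ p≺p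

  precedes-flip : ∀ {h h' p q} → Precedes h h' p q → Precedes h' h q p
  precedes-flip (precedes p≺q) = precedes (subst₂ _<_ (+-comm _ _) (+-comm _ _) p≺q)

  precedes-trans : ∀ {h h'} → Transitive (Precedes h h')
  precedes-trans {h} {h'} {p} {q} {r} (precedes p≺q) (precedes q≺r) =
    precedes (subst (h p + h' r <_) (+-comm (h' p) (h r))
      (exchange< (inj₁ (subst (h p + h' q <_) (+-comm (h q) (h' p)) p≺q))
                 (subst (_< h r + h' q) (+-comm (h q) (h' r)) q≺r)))

  precedes-at : ∀ {h h' p q} (w : Pt) → h p + w p ≤ h q + w q → h' q + w q < h' p + w p →
                Precedes h h' p q
  precedes-at _ p-beats q-beats = precedes (exchange< p-beats q-beats)

  not-precedes-at : ∀ {h h' p q} (w : Pt) → h p + w p ≤ h q + w q → h' q + w q ≤ h' p + w p →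
                    ¬ Precedes h h' q p
  not-precedes-at _ p-beats q-beats (precedes q≺p) = <⇒≱ q≺p (exchange≤ p-beats q-beats)

  type-exclusion : ∀ {h h' x y k l} → InType h x l → ¬ InType h x k → InType h y k →
                   InType h' y l → ¬ InType h' x k
  type-exclusion {x = x} {y} {k} {l} h-x∋l h-x∌k h-y∋k h'-y∋l h'-x∋k =
    not-precedes-at y (h-y∋k l) (h'-y∋l k)
      (precedes-flip (precedes-at x (h'-x∋k l) (outside-larger h-x∋l h-x∌k)))

  precedes-from-type : ∀ {α β w j l s} → TypeIs β w j l → InType α w s → s ≢ j → s ≢ l →
                       Precedes α β s l
  precedes-from-type {w = w} {l = l} β-type α∋s s≢j s≢l =
    precedes-at w (α∋s l) (outside-larger (type-∋₂ β-type) (type-∌ β-type s≢j s≢l))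

  common-type-unordered : ∀ {h h' w x y} → InType h w y → InType h' w x → ¬ Precedes h h' x y
  common-type-unordered {w = w} {x} {y} h∋y h'∋x = not-precedes-at w (h∋y x) (h'∋x y)

  shift : Pt → Fin 5 → ℝ → Pt
  shift w c Δ = updateAt w c (_+ Δ)

  shift-keeps-type : ∀ {h w p c Δ y} → InType h w p → ¬ InType h w c →
                     - ((h c + w c) - (h p + w p)) < Δ → InType h w y → InType h (shift w c Δ) y
  shift-keeps-type {h} {w} {p} {c} {Δ} {y} h∋p h∌c above-gap h∋y x =
    subst (_≤ h x + shift w c Δ x) (cong (h y +_) (sym (updateAt-minimal y c w y≢c))) (compare x)
    where
    y≢c : y ≢ c
    y≢c refl = h∌c h∋y
    compare : ∀ x → h y + w y ≤ h x + shift w c Δ x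
    compare x with x ≟ c
    ... | yes refl = subst (h y + w y ≤_)
                           (trans (+-assoc (h c) (w c) Δ) (cong (h c +_) (sym (updateAt-updates c w))))
                           (inj₁ (≤-<-trans (h∋y p) (neg-sub-< above-gap)))
    ... | no x≢c = subst (h y + w y ≤_) (cong (h x +_) (sym (updateAt-minimal x c w x≢c))) (h∋y x)

  shift-near : ∀ {w c Δ ε} → 0r < ε → Within ε Δ → NormLt (λ r → shift w c Δ r - w r) ε
  shift-near {w} {c} {Δ} 0<ε Δ-small r with r ≟ c
  ... | yes refl = subst (Within _) (sym (trans (cong (_- w r) (updateAt-updates r w)) (+-subˡ (w r) Δ)))
                         Δ-small
  ... | no r≢c = subst (Within _) (sym (trans (cong (_- w r) (updateAt-minimal r c w r≢c)) (+-inverseʳ (w r))))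
                       (within-zero 0<ε)

  rival : Hyp → Pt → Fin 5 → Fin 5
  rival h w c = proj₁ (argmin-except (λ x → h x + w x) c)

  tie-shift : Hyp → Pt → Fin 5 → ℝ
  tie-shift h w c = (h (rival h w c) + w (rival h w c)) - (h c + w c)

  retie : Hyp → Pt → Fin 5 → Pt
  retie h w c = shift w c (tie-shift h w c)

  retie-on : ∀ h w c → OnHyp h (retie h w c)
  retie-on h w c = c , s , ≢-sym s≢c , minimal c value-c , minimal s (value-other s≢c)
    where
    f : Fin 5 → ℝ
    f x = h x + w x
    s = rival h w c
    s≢c : s ≢ c
    s≢c = proj₁ (proj₂ (argmin-except f c))
    value : Fin 5 → ℝ
    value x = h x + retie h w c x
    value-c : value c ≡ f s
    value-c = trans (cong (h c +_) (updateAt-updates c w))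
                    (trans (sym (+-assoc (h c) (w c) _)) (+-sub (f c) (f s)))
    value-other : ∀ {x} → x ≢ c → value x ≡ f x
    value-other x≢c = cong (h _ +_) (updateAt-minimal _ c w x≢c)
    bounded : ∀ x → f s ≤ value x
    bounded x with x ≟ c
    ... | yes refl = inj₂ (sym value-c)
    ... | no x≢c = subst (f s ≤_) (sym (value-other x≢c)) (proj₂ (proj₂ (argmin-except f c)) x x≢c)
    minimal : ∀ y → value y ≡ f s → InType h (retie h w c) y
    minimal y value-y x = subst (_≤ value x) (sym value-y) (bounded x)

  -- For a δ-translate of h', the tie-making shift at c is within 2δ of 0, because
  -- c already ties with another index d for h' at w.
  tie-shift-small : ∀ {h' w c d v δ} → InType h' w c → InType h' w d → d ≢ c → NormLt v δ →
                    Within (δ + δ) (tie-shift (translate h' v) w c)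
  tie-shift-small {h'} {w} {c} {d} {v} {δ} h'∋c h'∋d d≢c v-small = lower , upper
    where
    f : Fin 5 → ℝ
    f x = translate h' v x + w x
    s = rival (translate h' v) w c
    gap : ∀ x → f x - f c ≡ ((h' x + w x) - (h' c + w c)) + (v c - v x)
    gap x = translate-gap (h' x) (v x) (w x) (h' c) (v c) (w c)
    lower : - (δ + δ) < f s - f c
    lower = subst (- (δ + δ) <_) (sym (gap s))
                  (nonneg-+ (h'∋c s) (proj₁ (diff-within (v-small c) (v-small s))))
    upper : f s - f c < δ + δ
    upper = ≤-<-trans (+-monoˡ-≤ (- f c) (proj₂ (proj₂ (argmin-except f c)) d d≢c))
                      (subst (_< δ + δ) (sym (gap d))
                             (nonpos-+ (h'∋d c) (proj₂ (diff-within (v-small c) (v-small d)))))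

  -- Stability criterion: if c ∈ type_h' w but c ∉ type_h w, then w lies in the
  -- stable intersection; moving coordinate c alone follows every small translate of h'.
  stable-if-types-differ : ∀ {h h' w c} → OnHyp h w → OnHyp h' w →
                           InType h' w c → ¬ InType h w c → InStable h h' w
  stable-if-types-differ {h} {h'} {w} {c} (p , q , p≢q , h∋p , h∋q) on-h' h'∋c h∌c ε 0<ε
    with small-positive 0<ε (sub-pos (outside-larger h∋p h∌c)) | other-index on-h' c
  ... | δ , 0<δ , 2δ≤ε , 2δ≤gap | d , d≢c , h'∋d = δ , 0<δ , near
    where
    near : ∀ v → NormLt v δ →
           ∃[ w~ ] (OnHyp h w~ × OnHyp (translate h' v) w~ × NormLt (λ r → w~ r - w r) ε)
    near v v-small = retie (translate h' v) w c , (p , q , p≢q , keep h∋p , keep h∋q) ,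
                     retie-on (translate h' v) w c , shift-near {w} {c} 0<ε (within-weaken 2δ≤ε Δ-small)
      where
      Δ-small : Within (δ + δ) (tie-shift (translate h' v) w c)
      Δ-small = tie-shift-small h'∋c h'∋d d≢c v-small
      keep : ∀ {y} → InType h w y → InType h (retie (translate h' v) w c) y
      keep = shift-keeps-type h∋p h∌c (≤-<-trans (neg-antitone-≤ 2δ≤gap) (proj₁ Δ-small))

  witness-type-⊆ : ∀ {h h' w c} → Witness h h' w → InType h' w c → ¬ ¬ InType h w c
  witness-type-⊆ (on-h , on-h' , unstable) h'∋c h∌c =
    unstable (stable-if-types-differ on-h on-h' h'∋c h∌c)

  chain-blocks-witness : ∀ {α β u j k l s t} →
                         Witness α β u → ¬ InType α u j → ¬ InType β u k →
                         Unique (j ∷ k ∷ l ∷ s ∷ t ∷ []) → Precedes α β s l → Precedes α β l t → ⊥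
  chain-blocks-witness {α} {β} {u} {l = l} {s = s} {t = t}
                       u-witness@(_ , (a , b , a≢b , β∋a , β∋b) , _) α∌j β∌k distinct s≺l l≺t =
    witness-type-⊆ u-witness β∋a λ α∋a → witness-type-⊆ u-witness β∋b λ α∋b →
    [ common-type-unordered α∋b β∋a , common-type-unordered α∋a β∋b ]′
      (chain-comparable precedes-trans s≺l l≺t (among α∋a β∋a) (among α∋b β∋b) a≢b)
    where
    among : ∀ {x} → InType α u x → InType β u x → x ∈ (l ∷ s ∷ t ∷ [])
    among α∋x β∋x = remaining distinct (λ { refl → α∌j α∋x }) (λ { refl → β∌k β∋x })

lemma4p6 : (R : RealField) → let open Tropical R in
    (n : ℕ) (W : Fin n → Pt) (H : Fin 5 → Hyp) →
    (∀ i → CoordHyp W (H i) i) →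
    (∀ i j → ¬ (i ≡ j) → ∃[ m ] Witness (H i) (H j) (W m)) →
    (i j k l : Fin 5) →
    ¬ (i ≡ j) → ¬ (i ≡ k) → ¬ (i ≡ l) → ¬ (j ≡ k) → ¬ (j ≡ l) → ¬ (k ≡ l) →
    ¬ ((∃[ m ] WitnessOfType (H i) (H k) (W m) j l) ×
    (∃[ m ] WitnessOfType (H i) (H j) (W m) k l))
lemma4p6 R n W H coordinate witness i j k l _ _ _ j≢k j≢l k≢l
         ((m , _ , _ , γ-type-w , β-type-w) , (m' , _ , _ , γ-type-w' , α-type-w')) =
  blocked (third-index (proj₁ (coordinate j m)) (proj₂ (coordinate j m)) α-w∌k)
          (third-index (proj₁ (coordinate k m')) β-w'∌j (proj₂ (coordinate k m')))
          (witness j k j≢k)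
  where
  open Tropical R
  open TropicalFacts R
  -- k ∉ type_α w and j ∉ type_β w', by comparing w and w' on γ = H i.
  α-w∌k : ¬ InType (H j) (W m) k
  α-w∌k = type-exclusion (type-∋₂ γ-type-w) (type-∌ γ-type-w (≢-sym j≢k) k≢l)
                         (type-∋₁ γ-type-w') (type-∋₂ α-type-w')
  β-w'∌j : ¬ InType (H k) (W m') j
  β-w'∌j = type-exclusion (type-∋₂ γ-type-w') (type-∌ γ-type-w' j≢k j≢l)
                          (type-∋₁ γ-type-w) (type-∋₂ β-type-w)
  blocked : ∃[ s ] (InType (H j) (W m) s × s ≢ j × s ≢ k × s ≢ l) →
            ∃[ t ] (InType (H k) (W m') t × t ≢ j × t ≢ k × t ≢ l) →
            ∃[ m'' ] Witness (H j) (H k) (W m'') → ⊥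
  blocked (s , α∋s , s≢j , s≢k , s≢l) (t , β∋t , t≢j , t≢k , t≢l) (m'' , u-witness) =
    chain-blocks-witness u-witness (proj₂ (coordinate j m'')) (proj₂ (coordinate k m''))
                         distinct s≺l l≺t
    where
    s≺l : Precedes (H j) (H k) s l
    s≺l = precedes-from-type β-type-w α∋s s≢j s≢l
    l≺t : Precedes (H j) (H k) l t
    l≺t = precedes-flip (precedes-from-type α-type-w' β∋t t≢k t≢l)
    s≢t : s ≢ t
    s≢t refl = precedes-irrefl (precedes-trans s≺l l≺t)
    distinct : Unique (j ∷ k ∷ l ∷ s ∷ t ∷ [])
    distinct = (j≢k ∷ j≢l ∷ ≢-sym s≢j ∷ ≢-sym t≢j ∷ []) ∷
               (k≢l ∷ ≢-sym s≢k ∷ ≢-sym t≢k ∷ []) ∷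
               (≢-sym s≢l ∷ ≢-sym t≢l ∷ []) ∷ (s≢t ∷ []) ∷ [] ∷ []
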